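{- For every integer $n\geq 2$, the Esakia space $\boldsymbol{X}_n^\infty$ has width at most $n$.
   Context: A poset (or Esakia space) has width at most $n$ if for every element $x$, ${\uparrow}x$ contains no antichain of $n+1$ elements. For $n\geq 2$, $\boldsymbol{X}_n$ is the poset with universe $\{a_1,\dots,a_n,b_1,\dots,b_n\}$ where $x\leq y$ iff $x=y$, or $x=a_1$ and $y\in\{b_2,\dots,b_n\}$, or $x=a_m$ for some $m>1$ and $y\in\{b_1,b_m\}$, with the discrete topology. $\boldsymbol{X}_n^\infty$ consists of $\omega$ disjoint copies $X^{(j)}$ ($j\in\omega$) of $\boldsymbol{X}_n$ plus a fresh top $\top$, ordered by: $x\leq y$ iff $y=\top$, or $x,y$ lie in the same copy and $x\leq y$ there, or $x\in X^{(j)}$, $y\in X^{(k)}$ with $j<k$; its open sets are those $U$ such that if $\top\in U$ then $\bigcup_{k\geq j}X^{(k)}\subseteq U$ for some $j$. -}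

module Defs where

open import Data.Nat using (ℕ; suc; _<_; _≤_)
open import Data.Fin using (Fin; zero; suc)
open import Data.Product using (Σ; _×_)
open import Data.Unit using (⊤)
open import Data.Empty using (⊥)
open import Relation.Binary.PropositionalEquality using (_≡_; _≢_)
open import Relation.Nullary using (¬_)

-- An antichain of n+1 elements is a family f : Fin (suc n) → A whose
-- members are pairwise incomparable for distinct indices (hence pairwise
-- distinct, since the order is reflexive).
WidthAtMost : {A : Set} → (A → A → Set) → ℕ → Set
WidthAtMost {A} _≼_ n =
  (x : A) → ¬ Σ (Fin (suc n) → A) (λ f →
      ((i : Fin (suc n)) → x ≼ f i)
    × ((i j : Fin (suc n)) → i ≢ j → ¬ (f i ≼ f j)))

-- Index 1 of the paper is Fin.zero.
IsFirst : {n : ℕ} → Fin n → Set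
IsFirst zero    = ⊤
IsFirst (suc _) = ⊥

data Xn (n : ℕ) : Set where
  a : Fin n → Xn n
  b : Fin n → Xn n

data _≤X_ {n : ℕ} : Xn n → Xn n → Set where
  ≤X-refl : {x : Xn n} → x ≤X x
  a1≤bj   : {i j : Fin n} → IsFirst i → ¬ IsFirst j → a i ≤X b j
  am≤b1   : {m j : Fin n} → ¬ IsFirst m → IsFirst j → a m ≤X b j
  am≤bm   : {m : Fin n} → ¬ IsFirst m → a m ≤X b m

data Xinf (n : ℕ) : Set where
  top : Xinf n
  cp  : ℕ → Xn n → Xinf n

data _≤∞_ {n : ℕ} : Xinf n → Xinf n → Set where
  ≤top   : {x : Xinf n} → x ≤∞ top
  same   : {j : ℕ} {x y : Xn n} → x ≤X y → cp j x ≤∞ cp j y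
  lower  : {j k : ℕ} {x y : Xn n} → j < k → cp j x ≤∞ cp k y

-- Topology of X_n^∞ (not needed for width, recorded for completeness):
-- U is open iff ⊤ ∈ U implies ⋃_{k ≥ j} X^(k) ⊆ U for some j.
IsOpenXinf : {n : ℕ} → (Xinf n → Set) → Set
IsOpenXinf {n} U = U top → Σ ℕ (λ j → (k : ℕ) → j ≤ k → (x : Xn n) → U (cp k x))

module Submission where

-- The width of X_n^∞ is at most n because X_n^∞ is covered by n chains.
--
-- The easy direction of Dilworth's theorem: if every element of an ordered
-- set carries one of n colours so that equally coloured elements are
-- comparable (a "chain cover"), then no n+1 elements are pairwise
-- incomparable, by the pigeonhole principle.  This gives the bound for every
-- principal upset at once.
--
-- A chain cover of X_n (n ≥ 2): the chains are {a_2, b_1}, {a_1, b_2} and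
-- {a_m, b_m} for m > 2, i.e. b_i gets colour i and a_i gets colour σ i, where
-- σ is the transposition of the first two indices.  Any chain cover of X_n
-- extends to X_n^∞: elements of different copies are comparable, and ⊤ is
-- comparable to everything, so it may receive an arbitrary colour.

open import Defs
open import Data.Nat using (ℕ; suc; _≤_; s≤s; z≤n)
open import Data.Nat.Properties using (<-cmp; n<1+n)
open import Data.Fin using (Fin; zero; suc)
open import Data.Fin.Properties using (pigeonhole; <⇒≢)
open import Data.Product using (Σ; _,_)
open import Data.Sum using (_⊎_; inj₁; inj₂)
open import Data.Unit using (tt)
open import Relation.Binary using (tri<; tri≈; tri>)
open import Relation.Binary.PropositionalEquality using (_≡_; refl; sym; cong; module ≡-Reasoning)

ChainCover : {A : Set} → (A → A → Set) → ℕ → Set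
ChainCover {A} _≼_ k =
  Σ (A → Fin k) (λ colour → (x y : A) → colour x ≡ colour y → x ≼ y ⊎ y ≼ x)

chainCover⇒widthAtMost : {A : Set} {_≼_ : A → A → Set} {n : ℕ} →
                         ChainCover _≼_ n → WidthAtMost _≼_ n
chainCover⇒widthAtMost {n = n} (colour , comparable) x (f , _ , incomparable)
  with pigeonhole (n<1+n n) (λ i → colour (f i))
... | i , j , i<j , sameColour with comparable (f i) (f j) sameColour
...   | inj₁ fi≼fj = incomparable i j (<⇒≢ i<j) fi≼fj
...   | inj₂ fj≼fi = incomparable j i (λ j≡i → <⇒≢ i<j (sym j≡i)) fj≼fi

liftChainCover : {n : ℕ} → Fin n → ChainCover (_≤X_ {n}) n → ChainCover (_≤∞_ {n}) n
liftChainCover {n} c⊤ (colour , comparable) = colour∞ , comparable∞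
  where
  colour∞ : Xinf n → Fin n
  colour∞ top      = c⊤
  colour∞ (cp _ x) = colour x

  comparable∞ : (u v : Xinf n) → colour∞ u ≡ colour∞ v → u ≤∞ v ⊎ v ≤∞ u
  comparable∞ top      _        _ = inj₂ ≤top
  comparable∞ (cp _ _) top      _ = inj₁ ≤top
  comparable∞ (cp j x) (cp k y) e with <-cmp j k
  ... | tri< j<k _ _ = inj₁ (lower j<k)
  ... | tri> _ _ k<j = inj₂ (lower k<j)
  ... | tri≈ _ refl _ with comparable x y e
  ...   | inj₁ x≤y = inj₁ (same x≤y)
  ...   | inj₂ y≤x = inj₂ (same y≤x)

module ChainsOfXn (m : ℕ) where

  σ : Fin (suc (suc m)) → Fin (suc (suc m))
  σ zero          = suc zero
  σ (suc zero)    = zero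
  σ (suc (suc i)) = suc (suc i)

  σ-involutive : (i : Fin (suc (suc m))) → σ (σ i) ≡ i
  σ-involutive zero          = refl
  σ-involutive (suc zero)    = refl
  σ-involutive (suc (suc i)) = refl

  σ-injective : {i j : Fin (suc (suc m))} → σ i ≡ σ j → i ≡ j
  σ-injective {i} {j} σi≡σj = begin
    i         ≡⟨ sym (σ-involutive i) ⟩
    σ (σ i)   ≡⟨ cong σ σi≡σj ⟩
    σ (σ j)   ≡⟨ σ-involutive j ⟩
    j         ∎
    where open ≡-Reasoning

  a≤bσ : (i : Fin (suc (suc m))) → a i ≤X b (σ i)
  a≤bσ zero          = a1≤bj tt (λ ())
  a≤bσ (suc zero)    = am≤b1 (λ ()) tt
  a≤bσ (suc (suc i)) = am≤bm (λ ())

  colour : Xn (suc (suc m)) → Fin (suc (suc m))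
  colour (a i) = σ i
  colour (b i) = i

  comparable : (x y : Xn (suc (suc m))) → colour x ≡ colour y → x ≤X y ⊎ y ≤X x
  comparable (a i) (a j) σi≡σj with σ-injective σi≡σj
  ... | refl = inj₁ ≤X-refl
  comparable (a i) (b .(σ i)) refl = inj₁ (a≤bσ i)
  comparable (b .(σ j)) (a j) refl = inj₂ (a≤bσ j)
  comparable (b i) (b .i) refl = inj₁ ≤X-refl

  chainCover : ChainCover (_≤X_ {suc (suc m)}) (suc (suc m))
  chainCover = colour , comparable

lemma6p3 : (n : ℕ) → 2 ≤ n → WidthAtMost (_≤∞_ {n}) n
lemma6p3 (suc (suc m)) (s≤s (s≤s z≤n)) =
  chainCover⇒widthAtMost (liftChainCover zero (ChainsOfXn.chainCover m))
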